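{- For all integers $v\ge4$ and $d\ge1$, $\left|\mathcal{D}_{v,d}(132, 312)\right| = \left|\mathcal{D}_{v,d}(213, 231)\right| = 2^{d-1}$.
   Context: A diamond with $v$ vertices ($v\ge4$) is the poset with a least element, a greatest element, and $v-2$ pairwise incomparable middle elements (in a fixed left-to-right order) strictly between them. $\mathcal{D}_{v,d}$ is the set of labellings of $d$ diamonds (placed left to right) by $1,\dots,vd$, each label used once, such that in each diamond least label $<$ each middle label $<$ greatest label. For $D\in\mathcal{D}_{v,d}$, $\pi_D$ is the permutation obtained by reading the diamonds left to right and, within each diamond, the least element, then the middle elements left to right, then the greatest element. $\mathcal{D}_{v,d}(P)$ is the set of $D$ with $\pi_D$ avoiding every classical pattern in $P$. -}

module Defs where

open import Data.Nat using (ℕ; zero; suc; _+_; _*_; _<ᵇ_; _≡ᵇ_)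
open import Data.Bool using (Bool; true; false; _∧_; _∨_; not; T)
open import Data.Bool.ListAction using (all; any)
open import Data.List using (List; []; _∷_; length; splitAt; take; drop; map; reverse)
open import Data.Vec using (Vec; toList)
open import Data.Fin using (Fin; toℕ)
open import Data.Product using (Σ; _×_)

-- A labelling D of d diamonds with v vertices is identified with the
-- word π_D (a list of the labels, read diamond by diamond: least,
-- middles left to right, greatest).  D ↦ π_D is a bijection onto the
-- permutations satisfying the diamond condition below.  Labels are
-- 0,…,vd-1 instead of 1,…,vd (order-isomorphic, irrelevant for patterns).

distinct : List ℕ → Bool
distinct [] = true
distinct (x ∷ xs) = not (any (λ y → x ≡ᵇ y) xs) ∧ distinct xs

lastOr : ℕ → List ℕ → ℕ
lastOr a [] = a
lastOr a (x ∷ xs) = lastOr x xs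

init′ : List ℕ → List ℕ
init′ [] = []
init′ (x ∷ []) = []
init′ (x ∷ y ∷ ys) = x ∷ init′ (y ∷ ys)

diamondOK : List ℕ → Bool
diamondOK [] = false
diamondOK (a ∷ rest) =
  all (λ m → (a <ᵇ m) ∧ (m <ᵇ lastOr a rest)) (init′ rest)

diamondsOK : (v d : ℕ) → List ℕ → Bool
diamondsOK v zero w = true
diamondsOK v (suc d) w = diamondOK (take v w) ∧ diamondsOK v d (drop v w)

sameOrder : ℕ → ℕ → ℕ → ℕ → Bool
sameOrder a b x y = (a <ᵇ b) ≡B (x <ᵇ y)
  where
  _≡B_ : Bool → Bool → Bool
  true ≡B true = true
  false ≡B false = true
  _ ≡B _ = false

subseqs : List ℕ → List (List ℕ)
subseqs [] = [] ∷ []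
subseqs (x ∷ xs) = map (x ∷_) (subseqs xs) Data.List.++ subseqs xs

orderIso : List ℕ → List ℕ → Bool
orderIso xs ps = (length xs ≡ᵇ length ps) ∧ pairs xs ps
  where
  compat : ℕ → ℕ → List ℕ → List ℕ → Bool
  compat x p (y ∷ ys) (q ∷ qs) = sameOrder x y p q ∧ sameOrder y x q p ∧ compat x p ys qs
  compat x p _ _ = true
  pairs : List ℕ → List ℕ → Bool
  pairs (x ∷ xs) (p ∷ ps) = compat x p xs ps ∧ pairs xs ps
  pairs _ _ = true

contains : List ℕ → List ℕ → Bool
contains w p = any (λ s → orderIso s p) (subseqs w)

avoidsAll : List ℕ → List (List ℕ) → Bool
avoidsAll w P = all (λ p → not (contains w p)) P

-- The set D_{v,d}(P): words of length vd over {0,…,vd-1} with pairwise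
-- distinct entries (i.e. permutations), satisfying the diamond
-- condition, avoiding every pattern in P.
word : {n : ℕ} → Vec (Fin n) n → List ℕ
word w = map toℕ (toList w)

inD : (v d : ℕ) → List (List ℕ) → Vec (Fin (v * d)) (v * d) → Bool
inD v d P w = distinct (word w) ∧ diamondsOK v d (word w) ∧ avoidsAll (word w) P

𝒟 : (v d : ℕ) → List (List ℕ) → Set
𝒟 v d P = Σ (Vec (Fin (v * d)) (v * d)) (λ w → T (inD v d P w))

-- A word avoids 213 and 231 exactly when every entry is the
-- maximum or the minimum of the entries from it onwards, and such a word is determined by its
-- sequence of max/min directions; avoiding 132 and 312 is the same condition on the reversed word.
-- In the suitably oriented word each diamond is a block whose entries are ordered first < middles <
-- last or first > middles > last, and given the max/min property this forces every entry of the
-- block except its last one to point to the same side.  The last entry of each of the first d − 1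
-- blocks may point either way, and nothing depends on the direction of the final entry, so the
-- labellings correspond to the bit vectors of length d − 1.  The argument needs only v ≥ 3.

module Submission where

open import Defs
open import Data.Bool using (Bool; true; false; T; not; _∧_)
open import Data.Bool.Properties using (T-∧; T-≡; T-irrelevant; ∧-comm; ∧-assoc; ∧-identityʳ)
open import Data.Empty using (⊥-elim)
open import Data.Fin using (Fin; toℕ; fromℕ<)
open import Data.Fin.Properties using (toℕ<n; toℕ-fromℕ<; toℕ-injective; *↔×; 2↔Bool)
open import Data.List using (List; []; _∷_; _++_; length; map; reverse; replicate; take; drop)
open import Data.List.Properties
  using (++-assoc; length-++; reverse-++; unfold-reverse; reverse-involutive; length-reverse; take-all; ∷-injectiveˡ; ∷-injectiveʳ)
open import Data.List.Membership.Propositional using (_∈_)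
open import Data.List.Relation.Binary.Permutation.Propositional using (↭-sym)
open import Data.List.Relation.Binary.Permutation.Propositional.Properties using (All-resp-↭; ↭-reverse)
open import Data.List.Relation.Binary.Sublist.Propositional using (_⊆_; []; _∷_; _∷ʳ_; from∈; to∈; minimum)
import Data.List.Relation.Binary.Sublist.Propositional.Properties as Sublist
open import Data.List.Relation.Unary.All as All using (All; []; _∷_)
import Data.List.Relation.Unary.All.Properties as All
open import Data.List.Relation.Unary.Any as Any using (Any; here)
import Data.List.Relation.Unary.Any.Properties as Any
open import Data.Nat using (ℕ; zero; suc; pred; _+_; _*_; _^_; _∸_; _<_; _≤_; _<ᵇ_; z≤n; s≤s)
open import Data.Nat.Properties
  using (<ᵇ⇒<; <⇒<ᵇ; ≡ᵇ⇒≡; ≡⇒≡ᵇ; <-asym; <-trans; <-irrefl; <-cmp; ≤-antisym; ≤-trans; ≤-refl; ≤-pred; <⇒≤;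
         m≤n+m; n<1+n; +-suc; +-comm; +-identityʳ; *-comm; +-monoʳ-≤; +-cancelˡ-≤; suc-injective)
open import Data.Product using (∃-syntax; _×_; _,_; proj₁; proj₂; swap; uncurry)
open import Data.Product.Function.NonDependent.Propositional using (_×-↔_)
open import Data.Sum using (_⊎_; inj₁; inj₂; [_,_])
open import Data.Unit using (tt)
open import Data.Vec using (Vec; []; _∷_; toList; uncons)
open import Function using (id; _∘_)
open import Function.Bundles using (_⇔_; _↔_; mk⇔; mk↔ₛ′; Equivalence)
open import Function.Properties.Inverse using (↔-trans; ↔-sym)
open import Relation.Binary using (tri<; tri≈; tri>)
open import Relation.Binary.PropositionalEquality
  using (_≡_; _≢_; refl; sym; trans; cong; cong₂; subst; module ≡-Reasoning)
open import Relation.Nullary using (¬_)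

∧⁻ : ∀ x {y} → T (x ∧ y) → T x × T y
∧⁻ true t = tt , t

∧⁺ : ∀ {x y} → T x → T y → T (x ∧ y)
∧⁺ {true} _ t = t

T-not⁻ : ∀ {b} → T (not b) → ¬ T b
T-not⁻ {false} _ ()

T-not⁺ : ∀ {b} → ¬ T b → T (not b)
T-not⁺ {true} ¬t = ¬t tt
T-not⁺ {false} _ = tt

<ᵇ-true : ∀ {a b} → a < b → (a <ᵇ b) ≡ true
<ᵇ-true a<b = Equivalence.to T-≡ (<⇒<ᵇ a<b)

<ᵇ-false : ∀ {a b} → b < a → (a <ᵇ b) ≡ false
<ᵇ-false {a} {b} b<a with a <ᵇ b in eq
... | false = refl
... | true = ⊥-elim (<-asym b<a (<ᵇ⇒< a b (Equivalence.from T-≡ eq)))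

Any-subseqs⁻ : ∀ {P : List ℕ → Set} w → Any P (subseqs w) → ∃[ s ] s ⊆ w × P s
Any-subseqs⁻ [] (here p) = [] , [] , p
Any-subseqs⁻ (x ∷ w) p with Any.++⁻ (map (x ∷_) (subseqs w)) p
... | inj₁ q = let s , s⊆w , ps = Any-subseqs⁻ w (Any.map⁻ q) in x ∷ s , refl ∷ s⊆w , ps
... | inj₂ q = let s , s⊆w , ps = Any-subseqs⁻ w q in s , x ∷ʳ s⊆w , ps

Any-subseqs⁺ : ∀ {P : List ℕ → Set} {s w} → s ⊆ w → P s → Any P (subseqs w)
Any-subseqs⁺ [] p = here p
Any-subseqs⁺ (y ∷ʳ s⊆w) p = Any.++⁺ʳ (map (y ∷_) _) (Any-subseqs⁺ s⊆w p)
Any-subseqs⁺ (refl ∷ s⊆w) p = Any.++⁺ˡ (Any.map⁺ (Any-subseqs⁺ s⊆w p))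

contains⁻ : ∀ w p → T (contains w p) → ∃[ s ] s ⊆ w × T (orderIso s p)
contains⁻ w p c = Any-subseqs⁻ w (Any.any⁻ _ (subseqs w) c)

contains⁺ : ∀ {s w} p → s ⊆ w → T (orderIso s p) → T (contains w p)
contains⁺ p s⊆w iso = Any.any⁺ _ (Any-subseqs⁺ s⊆w iso)

record Agree (a b p q : ℕ) : Set where
  constructor _,_
  field
    forth : T (sameOrder a b p q)
    back  : T (sameOrder b a q p)

agree-< : ∀ {a b p q} → Agree a b p q → p < q → a < b
agree-< {a} {b} {p} {q} (s , _) p<q with a <ᵇ b in eq
... | true = <ᵇ⇒< a b (Equivalence.from T-≡ eq)
... | false rewrite <ᵇ-true p<q = ⊥-elim s

agree : ∀ {a b p q} → a < b → p < q → Agree a b p q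
agree {a} {b} {p} {q} a<b p<q = forth , back
  where
  forth : T (sameOrder a b p q)
  forth rewrite <ᵇ-true a<b | <ᵇ-true p<q = tt
  back : T (sameOrder b a q p)
  back rewrite <ᵇ-false a<b | <ᵇ-false p<q = tt

agree-sym : ∀ {a b p q} → Agree a b p q → Agree b a q p
agree-sym (s , s′) = s′ , s

-- The conjuncts are passed explicitly: `T` is not injective, so they cannot be inferred.
orderIso₃⁻ : ∀ a b c p q r → T (orderIso (a ∷ b ∷ c ∷ []) (p ∷ q ∷ r ∷ [])) →
             Agree a b p q × Agree a c p r × Agree b c q r
orderIso₃⁻ a b c p q r t =
  let t₁ , t₂ = ∧⁻ (sameOrder a b p q ∧ sameOrder b a q p ∧ sameOrder a c p r ∧ sameOrder c a r p ∧ true) t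
      ab , t₁ = ∧⁻ (sameOrder a b p q) t₁
      ba , t₁ = ∧⁻ (sameOrder b a q p) t₁
      ac , t₁ = ∧⁻ (sameOrder a c p r) t₁
      ca , _ = ∧⁻ (sameOrder c a r p) t₁
      t₂ , _ = ∧⁻ (sameOrder b c q r ∧ sameOrder c b r q ∧ true) t₂
      bc , t₂ = ∧⁻ (sameOrder b c q r) t₂
      cb , _ = ∧⁻ (sameOrder c b r q) t₂
  in (ab , ba) , (ac , ca) , (bc , cb)

orderIso₃⁺ : ∀ {a b c p q r} → Agree a b p q → Agree a c p r → Agree b c q r →
             T (orderIso (a ∷ b ∷ c ∷ []) (p ∷ q ∷ r ∷ []))
orderIso₃⁺ (ab , ba) (ac , ca) (bc , cb) =
  ∧⁺ (∧⁺ ab (∧⁺ ba (∧⁺ ac (∧⁺ ca tt)))) (∧⁺ (∧⁺ bc (∧⁺ cb tt)) tt)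

contains₃⁻ : ∀ {w p q r} → T (contains w (p ∷ q ∷ r ∷ [])) →
             ∃[ a ] ∃[ b ] ∃[ c ] (a ∷ b ∷ c ∷ []) ⊆ w × Agree a b p q × Agree a c p r × Agree b c q r
contains₃⁻ {w} {p} {q} {r} t with contains⁻ w _ t
... | a ∷ b ∷ c ∷ [] , s , iso = a , b , c , s , orderIso₃⁻ a b c p q r iso
... | [] , _ , ()
... | _ ∷ [] , _ , ()
... | _ ∷ _ ∷ [] , _ , ()
... | _ ∷ _ ∷ _ ∷ _ ∷ _ , _ , ()

contains₃⁺ : ∀ {a b c w p q r} → (a ∷ b ∷ c ∷ []) ⊆ w →
             Agree a b p q → Agree a c p r → Agree b c q r → T (contains w (p ∷ q ∷ r ∷ []))
contains₃⁺ s ab ac bc = contains⁺ _ s (orderIso₃⁺ ab ac bc)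

Between : ℕ → ℕ → ℕ → Set
Between x y z = (y < x × x < z) ⊎ (z < x × x < y)

Straddled : List ℕ → Set
Straddled w = ∃[ x ] ∃[ y ] ∃[ z ] (x ∷ y ∷ z ∷ []) ⊆ w × Between x y z

private
  1<2 : 1 < 2
  1<2 = <ᵇ⇒< 1 2 tt
  2<3 : 2 < 3
  2<3 = <ᵇ⇒< 2 3 tt
  1<3 : 1 < 3
  1<3 = <ᵇ⇒< 1 3 tt

straddled⇔213⊎231 : ∀ {w} → Straddled w ⇔
  (T (contains w (2 ∷ 1 ∷ 3 ∷ [])) ⊎ T (contains w (2 ∷ 3 ∷ 1 ∷ [])))
straddled⇔213⊎231 {w} = mk⇔ to from
  where
  to : Straddled w → T (contains w (2 ∷ 1 ∷ 3 ∷ [])) ⊎ T (contains w (2 ∷ 3 ∷ 1 ∷ []))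
  to (x , y , z , s , inj₁ (y<x , x<z)) =
    inj₁ (contains₃⁺ s (agree-sym (agree y<x 1<2)) (agree x<z 2<3) (agree (<-trans y<x x<z) 1<3))
  to (x , y , z , s , inj₂ (z<x , x<y)) =
    inj₂ (contains₃⁺ s (agree x<y 2<3) (agree-sym (agree z<x 1<2)) (agree-sym (agree (<-trans z<x x<y) 1<3)))
  from : T (contains w (2 ∷ 1 ∷ 3 ∷ [])) ⊎ T (contains w (2 ∷ 3 ∷ 1 ∷ [])) → Straddled w
  from (inj₁ t) = let a , b , c , s , ab , ac , _ = contains₃⁻ {w} t in
    a , b , c , s , inj₁ (agree-< (agree-sym ab) 1<2 , agree-< ac 2<3)
  from (inj₂ t) = let a , b , c , s , ab , ac , _ = contains₃⁻ {w} t in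
    a , b , c , s , inj₂ (agree-< (agree-sym ac) 1<2 , agree-< ab 2<3)

straddled-reverse⇔132⊎312 : ∀ {w} → Straddled (reverse w) ⇔
  (T (contains w (1 ∷ 3 ∷ 2 ∷ [])) ⊎ T (contains w (3 ∷ 1 ∷ 2 ∷ [])))
straddled-reverse⇔132⊎312 {w} = mk⇔ to from
  where
  to : Straddled (reverse w) → T (contains w (1 ∷ 3 ∷ 2 ∷ [])) ⊎ T (contains w (3 ∷ 1 ∷ 2 ∷ []))
  to (x , y , z , s , inj₁ (y<x , x<z)) =
    inj₂ (contains₃⁺ (Sublist.reverse⁻ {as = z ∷ y ∷ x ∷ []} {bs = w} s)
      (agree-sym (agree (<-trans y<x x<z) 1<3)) (agree-sym (agree x<z 2<3)) (agree y<x 1<2))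
  to (x , y , z , s , inj₂ (z<x , x<y)) =
    inj₁ (contains₃⁺ (Sublist.reverse⁻ {as = z ∷ y ∷ x ∷ []} {bs = w} s)
      (agree (<-trans z<x x<y) 1<3) (agree z<x 1<2) (agree-sym (agree x<y 2<3)))
  from : T (contains w (1 ∷ 3 ∷ 2 ∷ [])) ⊎ T (contains w (3 ∷ 1 ∷ 2 ∷ [])) → Straddled (reverse w)
  from (inj₁ t) = let a , b , c , s , _ , ac , bc = contains₃⁻ {w} t in
    c , b , a , Sublist.reverse⁺ s , inj₂ (agree-< ac 1<2 , agree-< (agree-sym bc) 2<3)
  from (inj₂ t) = let a , b , c , s , _ , ac , bc = contains₃⁻ {w} t in
    c , b , a , Sublist.reverse⁺ s , inj₁ (agree-< bc 1<2 , agree-< (agree-sym ac) 2<3)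

forbidden : Bool → List (List ℕ)
forbidden true = (1 ∷ 3 ∷ 2 ∷ []) ∷ (3 ∷ 1 ∷ 2 ∷ []) ∷ []
forbidden false = (2 ∷ 1 ∷ 3 ∷ []) ∷ (2 ∷ 3 ∷ 1 ∷ []) ∷ []

orient : Bool → List ℕ → List ℕ
orient true = reverse
orient false w = w

avoids-pair⇔¬ : ∀ {w p q} {S : Set} → S ⇔ (T (contains w p) ⊎ T (contains w q)) →
                T (avoidsAll w (p ∷ q ∷ [])) ⇔ (¬ S)
avoids-pair⇔¬ {w} {p} {q} S⇔ with contains w p | contains w q
... | false | false = mk⇔ (λ _ s → [ (λ ()) , (λ ()) ] (Equivalence.to S⇔ s)) (λ _ → tt)
... | false | true = mk⇔ (λ ()) (λ ¬s → ¬s (Equivalence.from S⇔ (inj₂ tt)))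
... | true | _ = mk⇔ (λ ()) (λ ¬s → ¬s (Equivalence.from S⇔ (inj₁ tt)))

avoids⇔¬straddled : ∀ δ w → T (avoidsAll w (forbidden δ)) ⇔ (¬ Straddled (orient δ w))
avoids⇔¬straddled true w = avoids-pair⇔¬ {w} (straddled-reverse⇔132⊎312 {w})
avoids⇔¬straddled false w = avoids-pair⇔¬ {w} (straddled⇔213⊎231 {w})

Repeats : List ℕ → Set
Repeats w = ∃[ a ] (a ∷ a ∷ []) ⊆ w

straddled-∷ : ∀ {x r} → Straddled r → Straddled (x ∷ r)
straddled-∷ {x} (a , b , c , s , btw) = a , b , c , x ∷ʳ s , btw

repeats-∷ : ∀ {x r} → Repeats r → Repeats (x ∷ r)
repeats-∷ {x} (a , s) = a , x ∷ʳ s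

distinct⇔¬repeats : ∀ w → T (distinct w) ⇔ (¬ Repeats w)
distinct⇔¬repeats [] = mk⇔ (λ _ → λ { (_ , ()) }) (λ _ → tt)
distinct⇔¬repeats (x ∷ w) = mk⇔ to from
  where
  to : T (distinct (x ∷ w)) → ¬ Repeats (x ∷ w)
  to t (a , _ ∷ʳ s) = Equivalence.to (distinct⇔¬repeats w) (proj₂ (∧⁻ _ t)) (a , s)
  to t (a , refl ∷ s) =
    T-not⁻ (proj₁ (∧⁻ _ t)) (Any.any⁺ _ (Any.map (λ { refl → ≡⇒≡ᵇ x x refl }) (to∈ s)))
  from : ¬ Repeats (x ∷ w) → T (distinct (x ∷ w))
  from ¬rep = ∧⁺ (T-not⁺ (λ t → ¬rep (x , refl ∷ from∈ (Any.map (≡ᵇ⇒≡ x _) (Any.any⁻ _ w t)))))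
                 (Equivalence.from (distinct⇔¬repeats w) (¬rep ∘ repeats-∷))


repeats-orient : ∀ δ {w} → Repeats (orient δ w) → Repeats w
repeats-orient true {w} (a , s) = a , Sublist.reverse⁻ {as = a ∷ a ∷ []} {bs = w} s
repeats-orient false r = r

orient-involutive : ∀ δ w → orient δ (orient δ w) ≡ w
orient-involutive true = reverse-involutive
orient-involutive false w = refl

length-orient : ∀ δ w → length (orient δ w) ≡ length w
length-orient true = length-reverse
length-orient false w = refl

All-reverse⇔ : ∀ {P : ℕ → Set} xs → All P (reverse xs) ⇔ All P xs
All-reverse⇔ xs = mk⇔ (All-resp-↭ (↭-reverse xs)) (All-resp-↭ (↭-sym (↭-reverse xs)))

All-orient : ∀ δ {P : ℕ → Set} {w} → All P w → All P (orient δ w)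
All-orient true {w = w} = Equivalence.from (All-reverse⇔ w)
All-orient false a = a

-- Words whose entries are extreme among the later ones

Beyond : Bool → ℕ → ℕ → Set
Beyond true x y = y < x
Beyond false x y = x < y

Beyond-<ᵇ : ∀ δ {x y} → Beyond δ x y → (y <ᵇ x) ≡ δ
Beyond-<ᵇ true y<x = <ᵇ-true y<x
Beyond-<ᵇ false x<y = <ᵇ-false x<y

Beyond-unique : ∀ {c δ x y} → Beyond c x y → Beyond δ x y → c ≡ δ
Beyond-unique {c} {δ} p q = trans (sym (Beyond-<ᵇ c p)) (Beyond-<ᵇ δ q)

Beyond-trans : ∀ δ {x y z} → Beyond δ x y → Beyond δ y z → Beyond δ x z
Beyond-trans true y<x z<y = <-trans z<y y<x
Beyond-trans false x<y y<z = <-trans x<y y<z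

Beyond⇒≢ : ∀ δ {x y} → Beyond δ x y → x ≢ y
Beyond⇒≢ true y<x refl = <-irrefl refl y<x
Beyond⇒≢ false x<y refl = <-irrefl refl x<y

≢⇒Beyond : ∀ {x y} → x ≢ y → ∃[ δ ] Beyond δ x y
≢⇒Beyond {x} {y} x≢y with <-cmp x y
... | tri< x<y _ _ = false , x<y
... | tri≈ _ x≡y _ = ⊥-elim (x≢y x≡y)
... | tri> _ _ y<x = true , y<x

Beyond-or-Between : ∀ δ {x y z} → Beyond δ x y → x ≢ z → Beyond δ x z ⊎ Between x y z
Beyond-or-Between δ {x} {y} {z} xy x≢z with ≢⇒Beyond x≢z
Beyond-or-Between true y<x _ | true , z<x = inj₁ z<x
Beyond-or-Between true y<x _ | false , x<z = inj₂ (inj₁ (y<x , x<z))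
Beyond-or-Between false x<y _ | true , z<x = inj₂ (inj₂ (z<x , x<y))
Beyond-or-Between false x<y _ | false , x<z = inj₁ x<z

Beyond⇒¬Between : ∀ δ {x y z} → Beyond δ x y → Beyond δ x z → ¬ Between x y z
Beyond⇒¬Between true y<x z<x (inj₁ (_ , x<z)) = <-asym x<z z<x
Beyond⇒¬Between true y<x z<x (inj₂ (_ , x<y)) = <-asym x<y y<x
Beyond⇒¬Between false x<y x<z (inj₁ (y<x , _)) = <-asym x<y y<x
Beyond⇒¬Between false x<y x<z (inj₂ (z<x , _)) = <-asym x<z z<x

data Shaped : List Bool → List ℕ → Set where
  [] : Shaped [] []
  _∷_ : ∀ {δ x cs r} → All (Beyond δ x) r → Shaped cs r → Shaped (δ ∷ cs) (x ∷ r)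

Extremal : List ℕ → Set
Extremal r = ∃[ cs ] Shaped cs r

length-shaped : ∀ {cs r} → Shaped cs r → length r ≡ length cs
length-shaped [] = refl
length-shaped (_ ∷ sh) = cong suc (length-shaped sh)

shaped⇒¬repeats : ∀ {cs r} → Shaped cs r → ¬ Repeats r
shaped⇒¬repeats (_ ∷ sh) (a , _ ∷ʳ s) = shaped⇒¬repeats sh (a , s)
shaped⇒¬repeats {δ ∷ _} (xr ∷ _) (a , refl ∷ s) =
  Beyond⇒≢ δ (All.head (Sublist.All-resp-⊆ s xr)) refl

shaped⇒¬straddled : ∀ {cs r} → Shaped cs r → ¬ Straddled r
shaped⇒¬straddled (_ ∷ sh) (x , y , z , _ ∷ʳ s , b) = shaped⇒¬straddled sh (x , y , z , s , b)
shaped⇒¬straddled {δ ∷ _} (xr ∷ _) (x , y , z , refl ∷ s , b) with Sublist.All-resp-⊆ s xr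
... | xy ∷ xz ∷ [] = Beyond⇒¬Between δ xy xz b

¬repeats∧¬straddled⇒extremal : ∀ {r} → ¬ Repeats r → ¬ Straddled r → Extremal r
¬repeats∧¬straddled⇒extremal {[]} _ _ = [] , []
¬repeats∧¬straddled⇒extremal {x ∷ []} _ _ = true ∷ [] , [] ∷ []
¬repeats∧¬straddled⇒extremal {x ∷ y ∷ r} ¬rep ¬str
  with ¬repeats∧¬straddled⇒extremal (¬rep ∘ repeats-∷) (¬str ∘ straddled-∷)
     | ≢⇒Beyond {x} {y} (λ x≡y → ¬rep (x , refl ∷ x≡y ∷ minimum r))
... | cs , sh | δ , xy = δ ∷ cs , (xy ∷ All.tabulate beyond) ∷ sh
  where
  beyond : ∀ {z} → z ∈ r → Beyond δ x z
  beyond {z} z∈r = [ id , (λ btw → ⊥-elim (¬str (x , y , z , refl ∷ refl ∷ from∈ z∈r , btw))) ]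
    (Beyond-or-Between δ xy (λ { refl → ¬rep (x , refl ∷ y ∷ʳ from∈ z∈r) }))

Within : ℕ → ℕ → ℕ → Set
Within lo hi x = lo ≤ x × x < hi

extremalWord : ℕ → List Bool → List ℕ
extremalWord lo [] = []
extremalWord lo (true ∷ cs) = length cs + lo ∷ extremalWord lo cs
extremalWord lo (false ∷ cs) = lo ∷ extremalWord (suc lo) cs

extremalWord-within : ∀ lo cs → All (Within lo (length cs + lo)) (extremalWord lo cs)
extremalWord-within lo [] = []
extremalWord-within lo (true ∷ cs) =
  (m≤n+m lo (length cs) , n<1+n _) ∷
  All.map (λ (lo≤x , x<) → lo≤x , <-trans x< (n<1+n _)) (extremalWord-within lo cs)
extremalWord-within lo (false ∷ cs) =
  (≤-refl , s≤s (m≤n+m lo (length cs))) ∷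
  All.map (λ {x} (lo<x , x<) → <⇒≤ lo<x , subst (x <_) (+-suc (length cs) lo) x<) (extremalWord-within (suc lo) cs)

extremalWord-shaped : ∀ lo cs → Shaped cs (extremalWord lo cs)
extremalWord-shaped lo [] = []
extremalWord-shaped lo (true ∷ cs) = All.map proj₂ (extremalWord-within lo cs) ∷ extremalWord-shaped lo cs
extremalWord-shaped lo (false ∷ cs) =
  All.map proj₁ (extremalWord-within (suc lo) cs) ∷ extremalWord-shaped (suc lo) cs

shaped-length≤ : ∀ {cs r lo hi} → Shaped cs r → All (Within lo hi) r → lo ≤ hi → length r + lo ≤ hi
shaped-length≤ [] [] lo≤hi = lo≤hi
shaped-length≤ {true ∷ _} (xr ∷ sh) ((lo≤x , x<hi) ∷ w) _ =
  ≤-trans (s≤s (shaped-length≤ sh (All.zipWith (λ (z<x , (lo≤z , _)) → lo≤z , z<x) (xr , w)) lo≤x)) x<hi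
shaped-length≤ {false ∷ _} {_ ∷ r} {lo} {hi} (xr ∷ sh) ((lo≤x , x<hi) ∷ w) _ =
  subst (_≤ hi) (+-suc (length r) lo)
    (≤-trans (+-monoʳ-≤ (length r) (s≤s lo≤x))
             (shaped-length≤ sh (All.zipWith (λ (x<z , (_ , z<hi)) → x<z , z<hi) (xr , w)) x<hi))

shaped⇒extremalWord : ∀ {cs r lo} → Shaped cs r → All (Within lo (length cs + lo)) r →
                      r ≡ extremalWord lo cs
shaped⇒extremalWord [] [] = refl
shaped⇒extremalWord {true ∷ cs} {x ∷ r} {lo} (xr ∷ sh) ((lo≤x , x<) ∷ w) =
  cong₂ _∷_ x≡top (shaped⇒extremalWord sh (subst (λ h → All (Within lo h) r) x≡top below-x))
  where
  below-x : All (Within lo x) r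
  below-x = All.zipWith (λ (z<x , (lo≤z , _)) → lo≤z , z<x) (xr , w)
  x≡top : x ≡ length cs + lo
  x≡top = ≤-antisym (≤-pred x<)
            (subst (λ n → n + lo ≤ x) (length-shaped sh) (shaped-length≤ sh below-x lo≤x))
shaped⇒extremalWord {false ∷ cs} {x ∷ r} {lo} (xr ∷ sh) ((lo≤x , x<) ∷ w) =
  cong₂ _∷_ x≡lo
    (shaped⇒extremalWord sh (subst (λ l → All (Within (suc l) (length cs + suc lo)) r) x≡lo above-x))
  where
  above-x : All (Within (suc x) (length cs + suc lo)) r
  above-x = All.zipWith (λ {z} (x<z , (_ , z<)) → x<z , subst (z <_) (sym (+-suc (length cs) lo)) z<) (xr , w)
  x≡lo : x ≡ lo
  x≡lo = ≤-antisym (≤-pred (+-cancelˡ-≤ (length cs) _ _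
            (subst (λ n → n + suc x ≤ length cs + suc lo) (length-shaped sh)
              (shaped-length≤ sh above-x (subst (x <_) (sym (+-suc (length cs) lo)) x<)))))
          lo≤x

allBlocks : ℕ → (List ℕ → Bool) → ℕ → List ℕ → Bool
allBlocks v f zero w = true
allBlocks v f (suc d) w = f (take v w) ∧ allBlocks v f d (drop v w)

diamondsOK≡allBlocks : ∀ v d w → diamondsOK v d w ≡ allBlocks v diamondOK d w
diamondsOK≡allBlocks v zero w = refl
diamondsOK≡allBlocks v (suc d) w = cong (diamondOK (take v w) ∧_) (diamondsOK≡allBlocks v d (drop v w))

take-length-++ : ∀ (A B : List ℕ) → take (length A) (A ++ B) ≡ A
take-length-++ [] B = refl
take-length-++ (x ∷ A) B = cong (x ∷_) (take-length-++ A B)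

drop-length-++ : ∀ (A B : List ℕ) → drop (length A) (A ++ B) ≡ B
drop-length-++ [] B = refl
drop-length-++ (x ∷ A) B = drop-length-++ A B

splitAt-length : ∀ m {n} (w : List ℕ) → length w ≡ m + n →
                 ∃[ A ] ∃[ B ] w ≡ A ++ B × length A ≡ m × length B ≡ n
splitAt-length zero w eq = [] , w , refl , refl , eq
splitAt-length (suc m) (x ∷ w) eq with splitAt-length m w (cong pred eq)
... | A , B , refl , refl , eqB = x ∷ A , B , refl , refl , eqB

allBlocks-∷ : ∀ {v} f d (B w : List ℕ) → length B ≡ v →
              allBlocks v f (suc d) (B ++ w) ≡ f B ∧ allBlocks v f d w
allBlocks-∷ f d B w refl rewrite take-length-++ B w | drop-length-++ B w = refl

allBlocks-∷ʳ : ∀ {v} f d (A B : List ℕ) → length A ≡ d * v → length B ≡ v →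
               allBlocks v f (suc d) (A ++ B) ≡ allBlocks v f d A ∧ f B
allBlocks-∷ʳ f zero [] B _ refl =
  trans (cong (λ B′ → f B′ ∧ true) (take-all (length B) B ≤-refl)) (∧-identityʳ (f B))
allBlocks-∷ʳ {v} f (suc d) A B lA lB with splitAt-length v A lA
... | A₁ , A₂ , refl , lA₁ , lA₂ = begin
  allBlocks v f (suc (suc d)) ((A₁ ++ A₂) ++ B) ≡⟨ cong (allBlocks v f (suc (suc d))) (++-assoc A₁ A₂ B) ⟩
  allBlocks v f (suc (suc d)) (A₁ ++ A₂ ++ B)   ≡⟨ allBlocks-∷ f (suc d) A₁ (A₂ ++ B) lA₁ ⟩
  f A₁ ∧ allBlocks v f (suc d) (A₂ ++ B)        ≡⟨ cong (f A₁ ∧_) (allBlocks-∷ʳ f d A₂ B lA₂ lB) ⟩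
  f A₁ ∧ (allBlocks v f d A₂ ∧ f B)             ≡⟨ ∧-assoc (f A₁) _ _ ⟨
  (f A₁ ∧ allBlocks v f d A₂) ∧ f B             ≡⟨ cong (_∧ f B) (allBlocks-∷ f d A₁ A₂ lA₁) ⟨
  allBlocks v f (suc d) (A₁ ++ A₂) ∧ f B        ∎
  where open ≡-Reasoning

allBlocks-reverse : ∀ {v} f d (w : List ℕ) → length w ≡ d * v →
                    allBlocks v f d (reverse w) ≡ allBlocks v (f ∘ reverse) d w
allBlocks-reverse f zero w _ = refl
allBlocks-reverse {v} f (suc d) w lw with splitAt-length v w lw
... | B , w′ , refl , lB , lw′ = begin
  allBlocks v f (suc d) (reverse (B ++ w′))               ≡⟨ cong (allBlocks v f (suc d)) (reverse-++ B w′) ⟩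
  allBlocks v f (suc d) (reverse w′ ++ reverse B)         ≡⟨ allBlocks-∷ʳ f d (reverse w′) (reverse B)
                                                              (trans (length-reverse w′) lw′) (trans (length-reverse B) lB) ⟩
  allBlocks v f d (reverse w′) ∧ f (reverse B)            ≡⟨ cong (_∧ f (reverse B)) (allBlocks-reverse f d w′ lw′) ⟩
  allBlocks v (f ∘ reverse) d w′ ∧ f (reverse B)          ≡⟨ ∧-comm _ (f (reverse B)) ⟩
  f (reverse B) ∧ allBlocks v (f ∘ reverse) d w′          ≡⟨ allBlocks-∷ (f ∘ reverse) d B w′ lB ⟨
  allBlocks v (f ∘ reverse) (suc d) (B ++ w′)             ∎
  where open ≡-Reasoning

blockOK : Bool → List ℕ → Bool
blockOK true B = diamondOK (reverse B)
blockOK false B = diamondOK B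

diamondsOK-orient : ∀ v δ d r → length r ≡ d * v → diamondsOK v d (orient δ r) ≡ allBlocks v (blockOK δ) d r
diamondsOK-orient v true d r lr = trans (diamondsOK≡allBlocks v d (reverse r)) (allBlocks-reverse diamondOK d r lr)
diamondsOK-orient v false d r _ = diamondsOK≡allBlocks v d r

lastOr-snoc : ∀ a xs x → lastOr a (xs ++ x ∷ []) ≡ x
lastOr-snoc a [] x = refl
lastOr-snoc a (y ∷ xs) x = lastOr-snoc y xs x

init′-snoc : ∀ xs x → init′ (xs ++ x ∷ []) ≡ xs
init′-snoc [] x = refl
init′-snoc (y ∷ []) x = refl
init′-snoc (y ∷ z ∷ xs) x = cong (y ∷_) (init′-snoc (z ∷ xs) x)

length-snoc : ∀ (xs : List ℕ) x → length (xs ++ x ∷ []) ≡ suc (length xs)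
length-snoc xs x = trans (length-++ xs) (+-comm (length xs) 1)

diamondOK-snoc⇔ : ∀ l ms g → T (diamondOK (l ∷ ms ++ g ∷ [])) ⇔ All (λ m → l < m × m < g) ms
diamondOK-snoc⇔ l ms g rewrite lastOr-snoc l ms g | init′-snoc ms g =
  mk⇔ (All.map (λ t → let l<m , m<g = Equivalence.to T-∧ t in <ᵇ⇒< _ _ l<m , <ᵇ⇒< _ _ m<g) ∘ All.all⁺ _ ms)
      (All.all⁻ _ ∘ All.map (λ (l<m , m<g) → Equivalence.from T-∧ (<⇒<ᵇ l<m , <⇒<ᵇ m<g)))

blockOK-snoc⇔ : ∀ δ x₀ ms x → T (blockOK δ (x₀ ∷ ms ++ x ∷ [])) ⇔ All (λ m → Beyond δ x₀ m × Beyond δ m x) ms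
blockOK-snoc⇔ false x₀ ms x = diamondOK-snoc⇔ x₀ ms x
blockOK-snoc⇔ true x₀ ms x rewrite reverse-++ (x₀ ∷ ms) (x ∷ []) | unfold-reverse x₀ ms =
  mk⇔ (All.map swap ∘ Equivalence.to (All-reverse⇔ ms) ∘ Equivalence.to (diamondOK-snoc⇔ x (reverse ms) x₀))
      (Equivalence.from (diamondOK-snoc⇔ x (reverse ms) x₀) ∘ Equivalence.from (All-reverse⇔ ms) ∘ All.map swap)

All-last : ∀ {P : ℕ → Set} xs {x rest} → All P ((xs ++ x ∷ []) ++ rest) → P x
All-last xs {x} a = All.head (All.++⁻ʳ xs (All.++⁻ˡ (xs ++ x ∷ []) a))

run⇒beyond-last : ∀ δ xs {x rest cs} → Shaped (replicate (length xs) δ ++ cs) ((xs ++ x ∷ []) ++ rest) →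
           All (λ z → Beyond δ z x) xs
run⇒beyond-last δ [] _ = []
run⇒beyond-last δ (z ∷ xs) (zr ∷ sh) = All-last xs zr ∷ run⇒beyond-last δ xs sh

run⇒tail : ∀ {δ} xs {x rest cs} → Shaped (replicate (length xs) δ ++ cs) ((xs ++ x ∷ []) ++ rest) →
           Shaped cs (x ∷ rest)
run⇒tail [] sh = sh
run⇒tail (z ∷ xs) (_ ∷ sh) = run⇒tail xs sh

run⇒blockOK : ∀ δ xs {x rest cs} → Shaped (replicate (length xs) δ ++ cs) ((xs ++ x ∷ []) ++ rest) →
              T (blockOK δ (xs ++ x ∷ []))
run⇒blockOK true [] _ = _
run⇒blockOK false [] _ = _
run⇒blockOK δ (x₀ ∷ ms) {x} (x₀r ∷ sh) =
  Equivalence.from (blockOK-snoc⇔ δ x₀ ms x)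
    (All.zip (All.++⁻ˡ ms (All.++⁻ˡ (ms ++ x ∷ []) x₀r) , run⇒beyond-last δ ms sh))

blockOK⇒beyond-last : ∀ δ x₀ m ms x → T (blockOK δ (x₀ ∷ (m ∷ ms) ++ x ∷ [])) →
                      All (λ z → Beyond δ z x) (x₀ ∷ m ∷ ms)
blockOK⇒beyond-last δ x₀ m ms x t with Equivalence.to (blockOK-snoc⇔ δ x₀ (m ∷ ms) x) t
... | (x₀m , mx) ∷ rest = Beyond-trans δ x₀m mx ∷ mx ∷ All.map proj₂ rest

extremal-suffix : ∀ xs {x rest cs} → Shaped cs ((xs ++ x ∷ []) ++ rest) → Extremal (x ∷ rest)
extremal-suffix [] sh = _ , sh
extremal-suffix (z ∷ xs) (_ ∷ sh) = extremal-suffix xs sh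

beyond-last⇒run : ∀ δ xs {x rest cs₀ cs} → Shaped cs₀ ((xs ++ x ∷ []) ++ rest) → All (λ z → Beyond δ z x) xs →
               Shaped cs (x ∷ rest) → Shaped (replicate (length xs) δ ++ cs) ((xs ++ x ∷ []) ++ rest)
beyond-last⇒run δ [] _ [] sh = sh
beyond-last⇒run δ (z ∷ xs) {rest = rest} (zr ∷ sh₀) (zx ∷ xsx) sh =
  subst (λ c → All (Beyond c z) ((xs ++ _ ∷ []) ++ rest)) (Beyond-unique (All-last xs zr) zx) zr
  ∷ beyond-last⇒run δ xs sh₀ xsx sh

descends : ℕ → List ℕ → Bool
descends x (y ∷ _) = y <ᵇ x
descends x [] = false

shaped-∷-descends : ∀ {c x y rest cs} → All (Beyond c x) (y ∷ rest) → Shaped cs (y ∷ rest) →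
            Shaped (descends x (y ∷ rest) ∷ cs) (x ∷ y ∷ rest)
shaped-∷-descends {c} {x} {y} {rest} xr sh =
  subst (λ b → All (Beyond b x) (y ∷ rest)) (sym (Beyond-<ᵇ c (All.head xr))) xr ∷ sh

-- The direction of the final entry is immaterial (it is extreme on both sides); it is set to δ.
directions : ℕ → Bool → ∀ {e} → Vec Bool e → List Bool
directions j δ [] = replicate j δ ++ δ ∷ []
directions j δ (b ∷ bs) = replicate j δ ++ b ∷ directions j δ bs

length-run : ∀ j (δ b : Bool) cs → length (replicate j δ ++ b ∷ cs) ≡ suc j + length cs
length-run zero δ b cs = refl
length-run (suc j) δ b cs = cong suc (length-run j δ b cs)

length-directions : ∀ j δ {e} (bs : Vec Bool e) → length (directions j δ bs) ≡ suc e * suc j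
length-directions j δ [] = length-run j δ δ []
length-directions j δ (b ∷ bs) = trans (length-run j δ b _) (cong (suc j +_) (length-directions j δ bs))

freeBits : ℕ → ∀ e → List ℕ → Vec Bool e
freeBits j zero r = []
freeBits j (suc e) r = descends (lastOr 0 (take (suc j) r)) (drop (suc j) r) ∷ freeBits j e (drop (suc j) r)

freeBits-∷ : ∀ e xs x rest →
             freeBits (length xs) (suc e) ((xs ++ x ∷ []) ++ rest) ≡ descends x rest ∷ freeBits (length xs) e rest
freeBits-∷ e xs x rest rewrite sym (length-snoc xs x) | take-length-++ (xs ++ x ∷ []) rest
  | drop-length-++ (xs ++ x ∷ []) rest | lastOr-snoc 0 xs x = refl

splitBlock : ∀ j {n} (r : List ℕ) → length r ≡ suc j + n →
             ∃[ xs ] ∃[ x ] ∃[ rest ] r ≡ (xs ++ x ∷ []) ++ rest × length xs ≡ j × length rest ≡ n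
splitBlock zero (x ∷ rest) eq = [] , x , rest , refl , refl , cong pred eq
splitBlock (suc j) {n} (y ∷ r) eq with splitBlock j {n} r (cong pred eq)
... | xs , x , rest , refl , lxs , lrest = y ∷ xs , x , rest , refl , cong suc lxs , lrest

T-allBlocks-∷ : ∀ f d xs x rest → T (allBlocks (suc (length xs)) f (suc d) ((xs ++ x ∷ []) ++ rest)) ⇔
                (T (f (xs ++ x ∷ [])) × T (allBlocks (suc (length xs)) f d rest))
T-allBlocks-∷ f d xs x rest rewrite allBlocks-∷ f d (xs ++ x ∷ []) rest (length-snoc xs x) = T-∧

shaped⇒allBlocks : ∀ j δ {e} (bs : Vec Bool e) {r} → Shaped (directions j δ bs) r →
                   T (allBlocks (suc j) (blockOK δ) (suc e) r)
shaped⇒allBlocks j δ bs {r} sh with splitBlock j r (trans (length-shaped sh) (length-directions j δ bs))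
shaped⇒allBlocks _ δ [] sh | xs , x , rest , refl , refl , _ =
  Equivalence.from (T-allBlocks-∷ (blockOK δ) 0 xs x rest) (run⇒blockOK δ xs sh , _)
shaped⇒allBlocks _ δ {suc e} (b ∷ bs) sh | xs , x , rest , refl , refl , _ with run⇒tail xs sh
... | _ ∷ sh′ = Equivalence.from (T-allBlocks-∷ (blockOK δ) (suc e) xs x rest)
                  (run⇒blockOK δ xs sh , shaped⇒allBlocks (length xs) δ bs sh′)

freeBits-directions : ∀ j δ {e} (bs : Vec Bool e) {r} → Shaped (directions j δ bs) r → freeBits j e r ≡ bs
freeBits-directions j δ [] sh = refl
freeBits-directions j δ (b ∷ bs) {r} sh
  with splitBlock j r (trans (length-shaped sh) (length-directions j δ (b ∷ bs)))
... | xs , x , [] , _ , _ , ()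
... | xs , x , y ∷ rest , refl , refl , _ with run⇒tail xs sh
... | xr ∷ sh′ =
  trans (freeBits-∷ _ xs x (y ∷ rest))
        (cong₂ _∷_ (Beyond-<ᵇ b (All.head xr)) (freeBits-directions (length xs) δ bs sh′))

allBlocks⇒shaped : ∀ k δ e {cs r} → Shaped cs r → length r ≡ suc e * suc (suc (suc k)) →
                   T (allBlocks (suc (suc (suc k))) (blockOK δ) (suc e) r) →
                   Shaped (directions (suc (suc k)) δ (freeBits (suc (suc k)) e r)) r
allBlocks⇒shaped k δ zero {r = r} sh lr t with splitBlock (suc (suc k)) r lr
... | x₀ ∷ m ∷ ms , x , [] , refl , refl , _ =
  beyond-last⇒run δ (x₀ ∷ m ∷ ms) sh (blockOK⇒beyond-last δ x₀ m ms x block) ([] ∷ [])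
  where block = proj₁ (Equivalence.to (T-allBlocks-∷ (blockOK δ) 0 (x₀ ∷ m ∷ ms) x []) t)
allBlocks⇒shaped k δ (suc e) {r = r} sh lr t with splitBlock (suc (suc k)) r lr
... | x₀ ∷ m ∷ ms , x , y ∷ rest , refl , refl , lrest
    with extremal-suffix (x₀ ∷ m ∷ ms) sh
       | Equivalence.to (T-allBlocks-∷ (blockOK δ) (suc e) (x₀ ∷ m ∷ ms) x (y ∷ rest)) t
... | _ ∷ _ , xr ∷ sh′ | block , blocks =
  subst (λ bs → Shaped (directions (length (x₀ ∷ m ∷ ms)) δ bs) ((x₀ ∷ m ∷ ms ++ x ∷ []) ++ y ∷ rest))
        (sym (freeBits-∷ e (x₀ ∷ m ∷ ms) x (y ∷ rest)))
        (beyond-last⇒run δ (x₀ ∷ m ∷ ms) sh (blockOK⇒beyond-last δ x₀ m ms x block)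
           (shaped-∷-descends xr (allBlocks⇒shaped (length ms) δ e sh′ lrest blocks)))

Vec-∷↔ : ∀ {A : Set} {n} → (A × Vec A n) ↔ Vec A (suc n)
Vec-∷↔ = mk↔ₛ′ (uncurry _∷_) uncons (λ { (_ ∷ _) → refl }) (λ _ → refl)

Fin2^↔Vec : ∀ e → Fin (2 ^ e) ↔ Vec Bool e
Fin2^↔Vec zero =
  mk↔ₛ′ (λ _ → []) (λ _ → Fin.zero) (λ { [] → refl }) (λ { Fin.zero → refl ; (Fin.suc ()) })
Fin2^↔Vec (suc e) = ↔-trans *↔× (↔-trans (2↔Bool ×-↔ Fin2^↔Vec e) Vec-∷↔)

toℕs : ∀ {n m} → Vec (Fin n) m → List ℕ
toℕs w = map toℕ (toList w)

toℕs-injective : ∀ {n m} {w w′ : Vec (Fin n) m} → toℕs w ≡ toℕs w′ → w ≡ w′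
toℕs-injective {w = []} {[]} _ = refl
toℕs-injective {w = x ∷ w} {y ∷ w′} eq =
  cong₂ _∷_ (toℕ-injective (∷-injectiveˡ eq)) (toℕs-injective (∷-injectiveʳ eq))

toℕs-bounded : ∀ {n m} (w : Vec (Fin n) m) → All (_< n) (toℕs w)
toℕs-bounded [] = []
toℕs-bounded (x ∷ w) = toℕ<n x ∷ toℕs-bounded w

length-toℕs : ∀ {n m} (w : Vec (Fin n) m) → length (toℕs w) ≡ m
length-toℕs [] = refl
length-toℕs (x ∷ w) = cong suc (length-toℕs w)

fromℕs : ∀ {n} m (L : List ℕ) → All (_< n) L → length L ≡ m → Vec (Fin n) m
fromℕs zero [] [] _ = []
fromℕs (suc m) (x ∷ L) (x<n ∷ L<n) eq = fromℕ< x<n ∷ fromℕs m L L<n (suc-injective eq)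

toℕs-fromℕs : ∀ {n} m L (L<n : All (_< n) L) eq → toℕs (fromℕs m L L<n eq) ≡ L
toℕs-fromℕs zero [] [] _ = refl
toℕs-fromℕs (suc m) (x ∷ L) (x<n ∷ L<n) eq =
  cong₂ _∷_ (toℕ-fromℕ< x<n) (toℕs-fromℕs m L L<n (suc-injective eq))

𝒟-≡ : ∀ {v d P} {s s′ : 𝒟 v d P} → proj₁ s ≡ proj₁ s′ → s ≡ s′
𝒟-≡ {s = w , t} {_ , t′} refl = cong (w ,_) (T-irrelevant t t′)

module Diamonds (k e : ℕ) (δ : Bool) where
  j = suc (suc k)
  v = suc j
  d = suc e
  n = v * d

  Valid : List ℕ → Set
  Valid L = T (distinct L ∧ diamondsOK v d L ∧ avoidsAll L (forbidden δ))

  valid⁻ : ∀ L → Valid L → T (distinct L) × T (diamondsOK v d L) × T (avoidsAll L (forbidden δ))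
  valid⁻ L t = let t₁ , t₂ = ∧⁻ (distinct L) t in t₁ , ∧⁻ (diamondsOK v d L) t₂

  layout : Vec Bool e → List ℕ
  layout bs = extremalWord 0 (directions j δ bs)

  layout-shaped : ∀ bs → Shaped (directions j δ bs) (layout bs)
  layout-shaped bs = extremalWord-shaped 0 (directions j δ bs)

  length-layout : ∀ bs → length (layout bs) ≡ d * v
  length-layout bs = trans (length-shaped (layout-shaped bs)) (length-directions j δ bs)

  length-directions≡n : ∀ (bs : Vec Bool e) → length (directions j δ bs) + 0 ≡ n
  length-directions≡n bs = trans (+-identityʳ _) (trans (length-directions j δ bs) (*-comm d v))

  canonical : Vec Bool e → List ℕ
  canonical bs = orient δ (layout bs)

  canonical-bounded : ∀ bs → All (_< n) (canonical bs)
  canonical-bounded bs = All-orient δ (All.map (λ {x} (_ , x<) → subst (x <_) (length-directions≡n bs) x<)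
                                               (extremalWord-within 0 (directions j δ bs)))

  length-canonical : ∀ bs → length (canonical bs) ≡ n
  length-canonical bs = trans (length-orient δ (layout bs)) (trans (length-layout bs) (*-comm d v))

  canonical-valid : ∀ bs → Valid (canonical bs)
  canonical-valid bs =
    ∧⁺ (Equivalence.from (distinct⇔¬repeats _) (shaped⇒¬repeats sh ∘ repeats-orient δ))
       (∧⁺ (subst T (sym (diamondsOK-orient v δ d (layout bs) (length-layout bs))) (shaped⇒allBlocks j δ bs sh))
           (Equivalence.from (avoids⇔¬straddled δ (canonical bs))
              (subst (¬_ ∘ Straddled) (sym (orient-involutive δ (layout bs))) (shaped⇒¬straddled sh))))
    where
    sh = layout-shaped bs

  canonicalVec : Vec Bool e → Vec (Fin n) n
  canonicalVec bs = fromℕs n (canonical bs) (canonical-bounded bs) (length-canonical bs)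

  word-canonicalVec : ∀ bs → word (canonicalVec bs) ≡ canonical bs
  word-canonicalVec bs = toℕs-fromℕs n (canonical bs) (canonical-bounded bs) (length-canonical bs)

  valid⇒canonical : ∀ {L} → All (_< n) L → length L ≡ n → Valid L → canonical (freeBits j e (orient δ L)) ≡ L
  valid⇒canonical {L} L<n length-L t with valid⁻ L t
  ... | distinct-L , diamonds-L , avoids-L = begin
    orient δ (layout (freeBits j e r)) ≡⟨ cong (orient δ) (sym r≡layout) ⟩
    orient δ r                          ≡⟨ orient-involutive δ L ⟩
    L                                   ∎
    where
    open ≡-Reasoning
    r = orient δ L
    extremal : Extremal r
    extremal = ¬repeats∧¬straddled⇒extremal
                 (Equivalence.to (distinct⇔¬repeats L) distinct-L ∘ repeats-orient δ)
                 (Equivalence.to (avoids⇔¬straddled δ L) avoids-L)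
    length-r : length r ≡ d * v
    length-r = trans (length-orient δ L) (trans length-L (*-comm v d))
    blocks : T (allBlocks v (blockOK δ) d r)
    blocks = subst T (trans (cong (diamondsOK v d) (sym (orient-involutive δ L)))
                            (diamondsOK-orient v δ d r length-r))
                     diamonds-L
    shaped : Shaped (directions j δ (freeBits j e r)) r
    shaped = allBlocks⇒shaped k δ e (proj₂ extremal) length-r blocks
    r≡layout : r ≡ layout (freeBits j e r)
    r≡layout = shaped⇒extremalWord shaped
      (All.map (λ {x} x<n → z≤n , subst (x <_) (sym (length-directions≡n (freeBits j e r))) x<n)
               (All-orient δ L<n))

  decode : Vec Bool e → 𝒟 v d (forbidden δ)
  decode bs = canonicalVec bs , subst Valid (sym (word-canonicalVec bs)) (canonical-valid bs)

  encode : 𝒟 v d (forbidden δ) → Vec Bool e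
  encode (w , _) = freeBits j e (orient δ (word w))

  encode-decode : ∀ bs → encode (decode bs) ≡ bs
  encode-decode bs = begin
    freeBits j e (orient δ (word (canonicalVec bs)))   ≡⟨ cong (freeBits j e ∘ orient δ) (word-canonicalVec bs) ⟩
    freeBits j e (orient δ (orient δ (layout bs)))    ≡⟨ cong (freeBits j e) (orient-involutive δ (layout bs)) ⟩
    freeBits j e (layout bs)                           ≡⟨ freeBits-directions j δ bs (layout-shaped bs) ⟩
    bs                                                 ∎
    where open ≡-Reasoning

  decode-encode : ∀ s → decode (encode s) ≡ s
  decode-encode (w , t) = 𝒟-≡ {v} {d} {forbidden δ}
    (toℕs-injective (trans (word-canonicalVec (encode (w , t)))
                           (valid⇒canonical (toℕs-bounded w) (length-toℕs w) t)))

  𝒟↔Vec : 𝒟 v d (forbidden δ) ↔ Vec Bool e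
  𝒟↔Vec = mk↔ₛ′ encode decode encode-decode decode-encode

𝒟↔Fin : ∀ k e δ → 𝒟 (3 + k) (suc e) (forbidden δ) ↔ Fin (2 ^ e)
𝒟↔Fin k e δ = ↔-trans (Diamonds.𝒟↔Vec k e δ) (↔-sym (Fin2^↔Vec e))

corollary3p6 : (v d : ℕ) → 4 ≤ v → 1 ≤ d →
    (𝒟 v d ((1 ∷ 3 ∷ 2 ∷ []) ∷ (3 ∷ 1 ∷ 2 ∷ []) ∷ []) ↔ Fin (2 ^ (d ∸ 1)))
    × (𝒟 v d ((2 ∷ 1 ∷ 3 ∷ []) ∷ (2 ∷ 3 ∷ 1 ∷ []) ∷ []) ↔ Fin (2 ^ (d ∸ 1)))
corollary3p6 (suc (suc (suc v))) (suc e) (s≤s (s≤s (s≤s _))) _ = 𝒟↔Fin v e true , 𝒟↔Fin v e false
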